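{- Let $n\geq 5$, let $P=(Y,X,Z)$ be a path of length two in $AQ_n$, and let $U\in N_{AQ_n}(P)$. Then $|N_{AQ_n}(U,X,Y,Z)|\geq 8n-31$. If moreover $Z=\overline{X}_n$, then $|N_{AQ_n}(U,X,Y,Z)|\geq 8n-29$.
   Context: The $n$-dimensional augmented cube $AQ_n$ has as vertex set all $n$-bit binary strings $X=x_nx_{n-1}\cdots x_1$. For $1\le i\le n$ let $X_i=x_n\cdots x_{i+1}\bar x_i x_{i-1}\cdots x_1$ (flip bit $i$) and $\overline{X}_i=x_n\cdots x_{i+1}\bar x_i\bar x_{i-1}\cdots\bar x_1$ (flip bits $i,i-1,\dots,1$). Two distinct vertices $X,Y$ are adjacent iff $Y=X_i$ for some $1\le i\le n$ or $Y=\overline{X}_i$ for some $2\le i\le n$. For a subgraph $T$, $N_{AQ_n}(T)=\bigcup_{W\in V(T)}N_{AQ_n}(W)\setminus V(T)$, where $N_{AQ_n}(W)$ is the neighbor set of $W$; for a set of vertices $A_1,\dots,A_k$, $N_{AQ_n}(A_1,\dots,A_k)=\bigcup_{j}N_{AQ_n}(A_j)\setminus\{A_1,\dots,A_k\}$. -}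

module Defs where

open import Data.Nat using (ℕ; zero; suc; _≤_; _≤ᵇ_)
open import Data.Bool using (Bool; true; false; not; if_then_else_)
open import Data.Bool.Properties renaming (_≟_ to _≟ᵇ_)
open import Data.Fin using (Fin; toℕ; fromℕ; _≟_)
open import Data.Fin.Properties using (any?)
open import Data.Vec using (Vec; []; _∷_; lookup; tabulate)
open import Data.Vec.Properties using (≡-dec)
open import Data.List using (List; []; _∷_; _++_; map; filter; length)
open import Data.List.Relation.Unary.Any using (Any)
open import Data.List.Relation.Unary.Any as Any using ()
open import Data.List.Membership.Propositional using (_∈_; _∉_)
open import Data.List.Membership.DecPropositional using ()
open import Data.Product using (Σ; _×_; _,_; ∃)
open import Data.Sum using (_⊎_)
open import Relation.Binary.PropositionalEquality using (_≡_; _≢_)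
open import Relation.Nullary using (Dec; yes; no; ¬_)
open import Relation.Nullary.Decidable using (_×-dec_; _⊎-dec_; ¬?)
import Data.Nat.Properties as ℕP

-- A vertex of AQ_n: an n-bit string.  Convention: position k : Fin n
-- (0-based) holds the bit x_{k+1}; i.e. lookup X k = x_{toℕ k + 1}.
Vertex : ℕ → Set
Vertex n = Vec Bool n

-- X_i with i = toℕ k + 1 : flip bit i.
flipBit : ∀ {n} → Vertex n → Fin n → Vertex n
flipBit X k = tabulate λ j → if toℕ j Data.Nat.≡ᵇ toℕ k then not (lookup X j) else lookup X j
  where import Data.Nat

-- overline X_i with i = toℕ k + 1 : flip bits i, i-1, ..., 1.
flipUpTo : ∀ {n} → Vertex n → Fin n → Vertex n
flipUpTo X k = tabulate λ j → if toℕ j ≤ᵇ toℕ k then not (lookup X j) else lookup X j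

flipTop : ∀ {n} → Vertex n → Vertex n
flipTop {zero} X = X
flipTop {suc m} X = flipUpTo X (fromℕ m)

_≟v_ : ∀ {n} (X Y : Vertex n) → Dec (X ≡ Y)
_≟v_ = ≡-dec _≟ᵇ_

Adj : ∀ {n} → Vertex n → Vertex n → Set
Adj {n} X Y = X ≢ Y ×
  ((∃ λ (k : Fin n) → Y ≡ flipBit X k) ⊎ (∃ λ (k : Fin n) → 1 ≤ toℕ k × Y ≡ flipUpTo X k))

adj? : ∀ {n} (X Y : Vertex n) → Dec (Adj X Y)
adj? X Y = ¬? (X ≟v Y) ×-dec
  (any? (λ k → Y ≟v flipBit X k) ⊎-dec any? (λ k → (1 ℕP.≤? toℕ k) ×-dec (Y ≟v flipUpTo X k)))

allVertices : (n : ℕ) → List (Vertex n)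
allVertices zero = [] ∷ []
allVertices (suc n) = map (false ∷_) (allVertices n) ++ map (true ∷_) (allVertices n)

InNbhd : ∀ {n} → List (Vertex n) → Vertex n → Set
InNbhd S W = Any (λ A → Adj A W) S × W ∉ S

inNbhd? : ∀ {n} (S : List (Vertex n)) (W : Vertex n) → Dec (InNbhd S W)
inNbhd? S W = Any.any? (λ A → adj? A W) S ×-dec ¬? (Any.any? (λ A → W ≟v A) S)

nbhd : ∀ {n} → List (Vertex n) → List (Vertex n)
nbhd {n} S = filter (inNbhd? S) (allVertices n)

nbhdSize : ∀ {n} → List (Vertex n) → ℕ
nbhdSize S = length (nbhd S)

IsPath2 : ∀ {n} → Vertex n → Vertex n → Vertex n → Set
IsPath2 Y X Z = Adj Y X × Adj X Z × Y ≢ Z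

-- Split AQ_n along the top bit x_n into two copies of AQ_(n-1).  For a set S of k ≤ 4 vertices,
-- induction on n gives |N(S)| ≥ 2nk − c_k + q(S), where q(S) counts the members of S whose
-- complement lies in S and (c_k) = 0, 1, 8, 18, 31.  If S meets both copies, the neighbourhoods
-- inside the two copies are disjoint and c absorbs the loss.  If S lies in one copy T, every
-- V ∈ T has the cross neighbours V_n and V̄_n in the other copy, which give 2k − q(T) further
-- neighbours, while q(S) = 0.  For the four vertices U, X, Y, Z this is 8n − 31, and Z = X̄_n
-- makes X, Z a complementary pair, so q ≥ 2.
module Submission where

open import Data.Bool using (Bool; true; false; not; if_then_else_)
open import Data.Bool.Properties using (not-¬; ¬-not; not-involutive) renaming (_≟_ to _≟ᵇ_)
open import Data.Fin using (zero; suc; toℕ; fromℕ; inject₁)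
open import Data.Fin.Properties using (toℕ-inject₁; toℕ-fromℕ)
open import Data.List using (List; []; _∷_; _++_; map; filter; length)
open import Data.List.Membership.Propositional using (_∈_; _∉_; find; lose)
open import Data.List.Membership.Propositional.Properties
  using (∈-map⁺; ∈-map⁻; ∈-filter⁺; ∈-filter⁻; ∈-++⁺ˡ; ∈-++⁺ʳ)
open import Data.List.Properties using (length-++; filter-++; filter-none; filter-some)
open import Data.List.Relation.Binary.Sublist.Propositional using (⊆-refl)
open import Data.List.Relation.Binary.Sublist.Propositional.Properties using (filter⁺; length-mono-≤)
open import Data.List.Relation.Unary.All as All using ([]; _∷_)
open import Data.List.Relation.Unary.All.Properties using (All¬⇒¬Any)
open import Data.List.Relation.Unary.Any as Any using (here; there)
open import Data.List.Relation.Unary.Unique.Propositional using (Unique; []; _∷_)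
open import Data.Nat using (ℕ; zero; suc; _+_; _*_; _∸_; _≤_; _≤ᵇ_; z≤n; s≤s)
open import Data.Nat.Properties
open import Data.Nat.Tactic.RingSolver using (solve-∀)
open import Data.Product using (_×_; _,_; proj₁; proj₂)
open import Data.Sum using (_⊎_; inj₁; inj₂)
open import Data.Vec as Vec using ([]; _∷_; _∷ʳ_; lookup; init; last; initLast)
open import Data.Vec.Properties
  using (tabulate∘lookup; tabulate-cong; map-∷ʳ; map-∘; map-cong; map-id;
         ∷ʳ-injectiveˡ; ∷ʳ-injectiveʳ; ∷-injective; init-∷ʳ; last-∷ʳ)
open import Defs
open import Function using (_∘_)
open import Level using (Level)
open import Relation.Binary.PropositionalEquality
open import Relation.Nullary using (Dec; yes; no; ¬_; contradiction)
open import Relation.Nullary.Decidable using (_×-dec_; _⊎-dec_)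
open import Relation.Unary using (Pred; Decidable; _⊆_)
open import Algebra.Properties.CommutativeSemigroup +-commutativeSemigroup
  using (interchange; x∙yz≈xz∙y; xy∙z≈xz∙y; x∙yz≈zx∙y)

private variable
  ℓ p q : Level
  A B : Set ℓ
  n : ℕ

complement : Vertex n → Vertex n
complement = Vec.map not

complement-involutive : (V : Vertex n) → complement (complement V) ≡ V
complement-involutive V =
  trans (sym (map-∘ not not V)) (trans (map-cong not-involutive V) (map-id V))

≤ᵇ-suc : ∀ i j → (suc i ≤ᵇ suc j) ≡ (i ≤ᵇ j)
≤ᵇ-suc zero    j = refl
≤ᵇ-suc (suc i) j = refl

flipBit-zero : ∀ x (V : Vertex n) → flipBit (x ∷ V) zero ≡ not x ∷ V
flipBit-zero x V = cong (not x ∷_) (tabulate∘lookup V)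

flipUpTo-zero : ∀ x (V : Vertex n) → flipUpTo (x ∷ V) zero ≡ not x ∷ V
flipUpTo-zero x V = cong (not x ∷_) (tabulate∘lookup V)

flipUpTo-suc : ∀ x (V : Vertex n) k → flipUpTo (x ∷ V) (suc k) ≡ not x ∷ flipUpTo V k
flipUpTo-suc x V k = cong (not x ∷_) (tabulate-cong λ j →
  cong (λ c → if c then not (lookup V j) else lookup V j) (≤ᵇ-suc (toℕ j) (toℕ k)))

flipBit-inject₁ : ∀ (V : Vertex n) b k → flipBit (V ∷ʳ b) (inject₁ k) ≡ flipBit V k ∷ʳ b
flipBit-inject₁ (x ∷ V) b zero    =
  trans (flipBit-zero x (V ∷ʳ b)) (cong (_∷ʳ b) (sym (flipBit-zero x V)))
flipBit-inject₁ (x ∷ V) b (suc k) = cong (x ∷_) (flipBit-inject₁ V b k)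

flipUpTo-inject₁ : ∀ (V : Vertex n) b k → flipUpTo (V ∷ʳ b) (inject₁ k) ≡ flipUpTo V k ∷ʳ b
flipUpTo-inject₁ (x ∷ V) b zero    =
  trans (flipUpTo-zero x (V ∷ʳ b)) (cong (_∷ʳ b) (sym (flipUpTo-zero x V)))
flipUpTo-inject₁ (x ∷ V) b (suc k) = begin
  flipUpTo (x ∷ (V ∷ʳ b)) (suc (inject₁ k)) ≡⟨ flipUpTo-suc x (V ∷ʳ b) (inject₁ k) ⟩
  not x ∷ flipUpTo (V ∷ʳ b) (inject₁ k)     ≡⟨ cong (not x ∷_) (flipUpTo-inject₁ V b k) ⟩
  not x ∷ (flipUpTo V k ∷ʳ b)               ≡⟨ cong (_∷ʳ b) (flipUpTo-suc x V k) ⟨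
  flipUpTo (x ∷ V) (suc k) ∷ʳ b             ∎
  where open ≡-Reasoning

flipBit-fromℕ : ∀ (V : Vertex n) b → flipBit (V ∷ʳ b) (fromℕ n) ≡ V ∷ʳ not b
flipBit-fromℕ []      b = flipBit-zero b []
flipBit-fromℕ (x ∷ V) b = cong (x ∷_) (flipBit-fromℕ V b)

flipUpTo-fromℕ : (V : Vertex (suc n)) → flipUpTo V (fromℕ n) ≡ complement V
flipUpTo-fromℕ (x ∷ [])    = flipUpTo-zero x []
flipUpTo-fromℕ (x ∷ y ∷ V) =
  trans (flipUpTo-suc x (y ∷ V) (fromℕ _)) (cong (not x ∷_) (flipUpTo-fromℕ (y ∷ V)))

flipTop≡complement : (X : Vertex n) → flipTop X ≡ complement X
flipTop≡complement {zero}  [] = refl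
flipTop≡complement {suc n} X  = flipUpTo-fromℕ X

Adj-∷ʳ : ∀ {V W : Vertex n} b → Adj V W → Adj (V ∷ʳ b) (W ∷ʳ b)
Adj-∷ʳ {V = V} {W} b (V≢W , inj₁ (k , W≡)) =
  V≢W ∘ ∷ʳ-injectiveˡ V W ,
  inj₁ (inject₁ k , trans (cong (_∷ʳ b) W≡) (sym (flipBit-inject₁ V b k)))
Adj-∷ʳ {V = V} {W} b (V≢W , inj₂ (k , 1≤k , W≡)) =
  V≢W ∘ ∷ʳ-injectiveˡ V W ,
  inj₂ (inject₁ k , subst (1 ≤_) (sym (toℕ-inject₁ k)) 1≤k ,
        trans (cong (_∷ʳ b) W≡) (sym (flipUpTo-inject₁ V b k)))

Adj-∷ʳ-not : ∀ (V : Vertex n) b → Adj (V ∷ʳ b) (V ∷ʳ not b)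
Adj-∷ʳ-not {n} V b = not-¬ refl ∘ ∷ʳ-injectiveʳ V V , inj₁ (fromℕ n , sym (flipBit-fromℕ V b))

Adj-complement-∷ʳ-not : ∀ (V : Vertex n) b → Adj (complement V ∷ʳ b) (V ∷ʳ not b)
Adj-complement-∷ʳ-not {zero}  [] b = Adj-∷ʳ-not [] b
Adj-complement-∷ʳ-not {suc n} V  b =
  not-¬ refl ∘ ∷ʳ-injectiveʳ (complement V) V ,
  inj₂ (fromℕ (suc n) , subst (1 ≤_) (sym (toℕ-fromℕ (suc n))) (s≤s z≤n) , sym (begin
    flipUpTo (complement V ∷ʳ b) (fromℕ (suc n)) ≡⟨ flipUpTo-fromℕ (complement V ∷ʳ b) ⟩
    complement (complement V ∷ʳ b)                ≡⟨ map-∷ʳ not b (complement V) ⟩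
    complement (complement V) ∷ʳ not b            ≡⟨ cong (_∷ʳ not b) (complement-involutive V) ⟩
    V ∷ʳ not b                                    ∎))
  where open ≡-Reasoning

count : {P : Pred A p} → Decidable P → List A → ℕ
count P? xs = length (filter P? xs)

module _ {P : Pred A p} (P? : Decidable P) where

  count-++ : ∀ xs ys → count P? (xs ++ ys) ≡ count P? xs + count P? ys
  count-++ xs ys = trans (cong length (filter-++ P? xs ys)) (length-++ (filter P? xs))

  count-map : ∀ (f : B → A) xs → count P? (map f xs) ≡ count (P? ∘ f) xs
  count-map f []       = refl
  count-map f (x ∷ xs) with P? (f x)
  ... | yes _ = cong suc (count-map f xs)
  ... | no  _ = count-map f xs

  count-none : (∀ x → ¬ P x) → ∀ xs → count P? xs ≡ 0
  count-none ¬P xs = cong length (filter-none P? {xs} (All.tabulate λ {x} _ → ¬P x))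

  count≡0⇒¬ : ∀ {x xs} → count P? xs ≡ 0 → x ∈ xs → ¬ P x
  count≡0⇒¬ c≡0 x∈xs px = <-irrefl (sym c≡0) (filter-some P? (lose x∈xs px))

module _ {P : Pred A p} {Q : Pred A q} (P? : Decidable P) (Q? : Decidable Q) where

  count-mono : P ⊆ Q → ∀ xs → count P? xs ≤ count Q? xs
  count-mono P⊆Q xs = length-mono-≤ (filter⁺ P? Q? (λ { refl → P⊆Q }) (⊆-refl {x = xs}))

  count-∪-∩ : ∀ xs → count (λ x → P? x ⊎-dec Q? x) xs + count (λ x → P? x ×-dec Q? x) xs
                     ≡ count P? xs + count Q? xs
  count-∪-∩ []       = refl
  count-∪-∩ (x ∷ xs) with P? x | Q? x | count-∪-∩ xs
  ... | yes _ | yes _ | ih = cong suc (trans (+-suc _ _) (trans (cong suc ih) (sym (+-suc _ _))))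
  ... | yes _ | no  _ | ih = cong suc ih
  ... | no  _ | yes _ | ih = trans (cong suc ih) (sym (+-suc _ _))
  ... | no  _ | no  _ | ih = ih

count-cong : {P : Pred A p} {Q : Pred A q} (P? : Decidable P) (Q? : Decidable Q) →
             P ⊆ Q → Q ⊆ P → ∀ xs → count P? xs ≡ count Q? xs
count-cong P? Q? P⊆Q Q⊆P xs = ≤-antisym (count-mono P? Q? P⊆Q xs) (count-mono Q? P? Q⊆P xs)

∈-allVertices : (V : Vertex n) → V ∈ allVertices n
∈-allVertices []          = here refl
∈-allVertices (false ∷ V) = ∈-++⁺ˡ (∈-map⁺ (false ∷_) (∈-allVertices V))
∈-allVertices (true ∷ V)  =
  ∈-++⁺ʳ (map (false ∷_) (allVertices _)) (∈-map⁺ (true ∷_) (∈-allVertices V))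

countAll : {P : Pred (Vertex n) p} → Decidable P → ℕ
countAll {n = n} P? = count P? (allVertices n)

countAll-∷ : {P : Pred (Vertex (suc n)) p} (P? : Decidable P) →
             countAll P? ≡ countAll (λ V → P? (false ∷ V)) + countAll (λ V → P? (true ∷ V))
countAll-∷ {n = n} P? =
  trans (count-++ P? (map (false ∷_) (allVertices n)) (map (true ∷_) (allVertices n)))
        (cong₂ _+_ (count-map P? (false ∷_) (allVertices n)) (count-map P? (true ∷_) (allVertices n)))

countAll-∷ʳ : {P : Pred (Vertex (suc n)) p} (P? : Decidable P) →
              countAll P? ≡ countAll (λ V → P? (V ∷ʳ false)) + countAll (λ V → P? (V ∷ʳ true))
countAll-∷ʳ {n = zero}  P? = trans (countAll-∷ P?) (cong₂ _+_ (on-[] false) (on-[] true))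
  where
  on-[] : ∀ b → countAll (λ V → P? (b ∷ V)) ≡ countAll (λ V → P? (V ∷ʳ b))
  on-[] b = count-cong (λ V → P? (b ∷ V)) (λ V → P? (V ∷ʳ b))
                       (λ { {[]} p → p }) (λ { {[]} p → p }) (allVertices 0)
countAll-∷ʳ {n = suc n} P? = begin
  countAll P?
    ≡⟨ countAll-∷ P? ⟩
  countAll (λ V → P? (false ∷ V)) + countAll (λ V → P? (true ∷ V))
    ≡⟨ cong₂ _+_ (countAll-∷ʳ (λ V → P? (false ∷ V))) (countAll-∷ʳ (λ V → P? (true ∷ V))) ⟩
  (c₀₀ + c₀₁) + (c₁₀ + c₁₁)
    ≡⟨ interchange c₀₀ c₀₁ c₁₀ c₁₁ ⟩
  (c₀₀ + c₁₀) + (c₀₁ + c₁₁)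
    ≡⟨ cong₂ _+_ (countAll-∷ (λ V → P? (V ∷ʳ false))) (countAll-∷ (λ V → P? (V ∷ʳ true))) ⟨
  countAll (λ V → P? (V ∷ʳ false)) + countAll (λ V → P? (V ∷ʳ true)) ∎
  where
  open ≡-Reasoning
  c₀₀ = countAll (λ V → P? (false ∷ (V ∷ʳ false)))
  c₀₁ = countAll (λ V → P? (false ∷ (V ∷ʳ true)))
  c₁₀ = countAll (λ V → P? (true ∷ (V ∷ʳ false)))
  c₁₁ = countAll (λ V → P? (true ∷ (V ∷ʳ true)))

countAll-complement : {P : Pred (Vertex n) p} (P? : Decidable P) →
                      countAll (λ V → P? (complement V)) ≡ countAll P?
countAll-complement {n = zero}  P? =
  count-cong (λ V → P? (complement V)) P? (λ { {[]} p → p }) (λ { {[]} p → p }) (allVertices 0)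
countAll-complement {n = suc n} P? = begin
  countAll (λ V → P? (complement V))
    ≡⟨ countAll-∷ (λ V → P? (complement V)) ⟩
  countAll (λ V → P? (true ∷ complement V)) + countAll (λ V → P? (false ∷ complement V))
    ≡⟨ cong₂ _+_ (countAll-complement (λ V → P? (true ∷ V)))
                 (countAll-complement (λ V → P? (false ∷ V))) ⟩
  countAll (λ V → P? (true ∷ V)) + countAll (λ V → P? (false ∷ V))
    ≡⟨ +-comm (countAll (λ V → P? (true ∷ V))) (countAll (λ V → P? (false ∷ V))) ⟩
  countAll (λ V → P? (false ∷ V)) + countAll (λ V → P? (true ∷ V))
    ≡⟨ countAll-∷ P? ⟨
  countAll P? ∎
  where open ≡-Reasoning

countAll-≡ : (X : Vertex n) → countAll (_≟v X) ≡ 1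
countAll-≡ []      = refl
countAll-≡ (x ∷ X) = trans (countAll-∷ (_≟v (x ∷ X))) (split x)
  where
  same : ∀ c → countAll (λ V → (c ∷ V) ≟v (c ∷ X)) ≡ 1
  same c = trans (count-cong (λ V → (c ∷ V) ≟v (c ∷ X)) (_≟v X)
                             (proj₂ ∘ ∷-injective) (cong (c ∷_)) (allVertices _))
                 (countAll-≡ X)
  other : ∀ c → countAll (λ V → (c ∷ V) ≟v (not c ∷ X)) ≡ 0
  other c = count-none (λ V → (c ∷ V) ≟v (not c ∷ X)) (λ V → not-¬ refl ∘ proj₁ ∘ ∷-injective) (allVertices _)
  split : ∀ x → countAll (λ V → (false ∷ V) ≟v (x ∷ X)) + countAll (λ V → (true ∷ V) ≟v (x ∷ X)) ≡ 1
  split false = cong₂ _+_ (same false) (other true)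
  split true  = cong₂ _+_ (other false) (same true)

_∈?_ : (V : Vertex n) (S : List (Vertex n)) → Dec (V ∈ S)
V ∈? S = Any.any? (V ≟v_) S

-- Counting over all vertices makes card the number of distinct members of S.
card : List (Vertex n) → ℕ
card S = countAll (_∈? S)

antipodalCount : List (Vertex n) → ℕ
antipodalCount S = countAll (λ V → V ∈? S ×-dec complement V ∈? S)

antipodalCount≤card : (S : List (Vertex n)) → antipodalCount S ≤ card S
antipodalCount≤card S = count-mono (λ V → V ∈? S ×-dec complement V ∈? S) (_∈? S) proj₁ (allVertices _)

card-∷ : ∀ {X : Vertex n} {S} → X ∉ S → card (X ∷ S) ≡ suc (card S)
card-∷ {X = X} {S} X∉S = begin
  card (X ∷ S)
    ≡⟨ count-cong (_∈? (X ∷ S)) X∪S? (λ { (here e) → inj₁ e ; (there m) → inj₂ m })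
                                     (λ { (inj₁ e) → here e ; (inj₂ m) → there m }) (allVertices _) ⟩
  countAll X∪S?
    ≡⟨ +-identityʳ _ ⟨
  countAll X∪S? + 0
    ≡⟨ cong (countAll X∪S? +_) (count-none X∩S? (λ { _ (refl , X∈S) → X∉S X∈S }) (allVertices _)) ⟨
  countAll X∪S? + countAll X∩S?
    ≡⟨ count-∪-∩ (_≟v X) (_∈? S) (allVertices _) ⟩
  countAll (_≟v X) + card S
    ≡⟨ cong (_+ card S) (countAll-≡ X) ⟩
  suc (card S) ∎
  where
  open ≡-Reasoning
  X∪S? = λ V → (V ≟v X) ⊎-dec (V ∈? S)
  X∩S? = λ V → (V ≟v X) ×-dec (V ∈? S)

card-unique : (S : List (Vertex n)) → Unique S → card S ≡ length S
card-unique {n} [] [] = count-none (_∈? []) (λ _ ()) (allVertices n)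
card-unique (X ∷ S) (X∉S ∷ uniq) = trans (card-∷ (All¬⇒¬Any X∉S)) (cong suc (card-unique S uniq))

-- Bit x_n is the last entry of a vertex, so layer β S is the part of S in the copy x_n = β of
-- AQ_(n-1), with x_n dropped; V ∷ʳ β lifts V back into that copy.
layer : Bool → List (Vertex (suc n)) → List (Vertex n)
layer β S = map init (filter (λ W → last W ≟ᵇ β) S)

module _ (β : Bool) (S : List (Vertex (suc n))) where

  ∈-layer⁺ : ∀ {V} → V ∷ʳ β ∈ S → V ∈ layer β S
  ∈-layer⁺ {V} V∈S = subst (_∈ layer β S) (init-∷ʳ β V)
    (∈-map⁺ init (∈-filter⁺ (λ W → last W ≟ᵇ β) V∈S (last-∷ʳ β V)))

  ∈-layer⁻ : ∀ {V} → V ∈ layer β S → V ∷ʳ β ∈ S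
  ∈-layer⁻ V∈ with ∈-map⁻ init V∈
  ... | W , W∈ , refl with ∈-filter⁻ (λ W → last W ≟ᵇ β) W∈
  ... | W∈S , refl = subst (_∈ S) (proj₂ (proj₂ (initLast W))) W∈S

  InNbhd-layer : ∀ {V} → InNbhd (layer β S) V → InNbhd S (V ∷ʳ β)
  InNbhd-layer (adj , V∉) with find adj
  ... | B , B∈ , B~V = lose (∈-layer⁻ B∈) (Adj-∷ʳ β B~V) , V∉ ∘ ∈-layer⁺

  countAll-layer : countAll (λ V → (V ∷ʳ β) ∈? S) ≡ card (layer β S)
  countAll-layer = count-cong (λ V → (V ∷ʳ β) ∈? S) (_∈? layer β S) ∈-layer⁺ ∈-layer⁻ (allVertices n)

  nbhdSize-layer≤ : nbhdSize (layer β S) ≤ countAll (λ V → inNbhd? S (V ∷ʳ β))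
  nbhdSize-layer≤ = count-mono (inNbhd? (layer β S)) (λ V → inNbhd? S (V ∷ʳ β)) InNbhd-layer (allVertices n)

  ∉-emptyLayer : card (layer β S) ≡ 0 → ∀ {V} → V ∉ layer β S
  ∉-emptyLayer empty {V} = count≡0⇒¬ (_∈? layer β S) empty (∈-allVertices V)

countAll-∷ʳ-not : ∀ β {P : Pred (Vertex (suc n)) p} (P? : Decidable P) →
                  countAll P? ≡ countAll (λ V → P? (V ∷ʳ β)) + countAll (λ V → P? (V ∷ʳ not β))
countAll-∷ʳ-not false P? = countAll-∷ʳ P?
countAll-∷ʳ-not true  P? = trans (countAll-∷ʳ P?) (+-comm (countAll (λ V → P? (V ∷ʳ false))) _)

card-layers : ∀ β (S : List (Vertex (suc n))) → card S ≡ card (layer β S) + card (layer (not β) S)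
card-layers β S =
  trans (countAll-∷ʳ-not β (_∈? S)) (cong₂ _+_ (countAll-layer β S) (countAll-layer (not β) S))

card-layer≤ : ∀ β (S : List (Vertex (suc n))) → card (layer β S) ≤ card S
card-layer≤ β S = subst (card (layer β S) ≤_) (sym (card-layers β S)) (m≤m+n _ _)

nbhdSize-layers : ∀ β (S : List (Vertex (suc n))) →
                  nbhdSize (layer β S) + nbhdSize (layer (not β) S) ≤ nbhdSize S
nbhdSize-layers β S =
  subst (nbhdSize (layer β S) + nbhdSize (layer (not β) S) ≤_) (sym (countAll-∷ʳ-not β (inNbhd? S)))
        (+-mono-≤ (nbhdSize-layer≤ β S) (nbhdSize-layer≤ (not β) S))

antipodalCount-emptyLayer : ∀ β (S : List (Vertex (suc n))) → card (layer β S) ≡ 0 → antipodalCount S ≡ 0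
antipodalCount-emptyLayer β S empty = count-none (λ W → W ∈? S ×-dec complement W ∈? S) noPair (allVertices _)
  where
  noPair : ∀ W → ¬ (W ∈ S × complement W ∈ S)
  noPair W (W∈ , W̄∈) with initLast W
  ... | V , c , refl with c ≟ᵇ β
  ... | yes refl = ∉-emptyLayer β S empty (∈-layer⁺ β S W∈)
  ... | no  c≢β  = ∉-emptyLayer β S empty (∈-layer⁺ β S (subst (_∈ S) W̄≡ W̄∈))
    where
    W̄≡ : complement (V ∷ʳ c) ≡ complement V ∷ʳ β
    W̄≡ = trans (map-∷ʳ not c V) (cong (complement V ∷ʳ_) (sym (¬-not (c≢β ∘ sym))))

crossNeighbour : ∀ β (S : List (Vertex (suc n))) → card (layer (not β) S) ≡ 0 →
                 ∀ {V} → V ∈ layer β S ⊎ complement V ∈ layer β S → InNbhd S (V ∷ʳ not β)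
crossNeighbour β S empty {V} (inj₁ V∈) =
  lose (∈-layer⁻ β S V∈) (Adj-∷ʳ-not V β) , ∉-emptyLayer (not β) S empty ∘ ∈-layer⁺ (not β) S
crossNeighbour β S empty {V} (inj₂ V̄∈) =
  lose (∈-layer⁻ β S V̄∈) (Adj-complement-∷ʳ-not V β) , ∉-emptyLayer (not β) S empty ∘ ∈-layer⁺ (not β) S

card-∪-complement : (T : List (Vertex n)) →
                    countAll (λ V → V ∈? T ⊎-dec complement V ∈? T) + antipodalCount T ≡ card T + card T
card-∪-complement {n} T = trans (count-∪-∩ (_∈? T) (λ V → complement V ∈? T) (allVertices n))
                                (cong (card T +_) (countAll-complement (_∈? T)))

-- The least values with k ≤ defect k and defect a + defect b + 3 (a + b) ≤ defect (a + b):
-- 8 = 1 + 1 + 6, 18 = 1 + 8 + 9, 31 = 1 + 18 + 12.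
defect : ℕ → ℕ
defect 0 = 0
defect 1 = 1
defect 2 = 8
defect 3 = 18
defect _ = 31

≤-defect : ∀ k → k ≤ 4 → k ≤ defect k
≤-defect 0 _ = z≤n
≤-defect 1 _ = ≤ᵇ⇒≤ _ _ _
≤-defect 2 _ = ≤ᵇ⇒≤ _ _ _
≤-defect 3 _ = ≤ᵇ⇒≤ _ _ _
≤-defect 4 _ = ≤ᵇ⇒≤ _ _ _
≤-defect (suc (suc (suc (suc (suc _))))) (s≤s (s≤s (s≤s (s≤s ()))))

defect-superadditive : ∀ {a b} → 1 ≤ a → 1 ≤ b → a + b ≤ 4 →
                       defect a + defect b + 3 * (a + b) ≤ defect (a + b)
defect-superadditive {1} {1} _ _ _ = ≤ᵇ⇒≤ _ _ _
defect-superadditive {1} {2} _ _ _ = ≤ᵇ⇒≤ _ _ _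
defect-superadditive {1} {3} _ _ _ = ≤ᵇ⇒≤ _ _ _
defect-superadditive {2} {1} _ _ _ = ≤ᵇ⇒≤ _ _ _
defect-superadditive {2} {2} _ _ _ = ≤ᵇ⇒≤ _ _ _
defect-superadditive {3} {1} _ _ _ = ≤ᵇ⇒≤ _ _ _
defect-superadditive {1} {suc (suc (suc (suc _)))} _ _ (s≤s (s≤s (s≤s (s≤s ()))))
defect-superadditive {2} {suc (suc (suc _))}       _ _ (s≤s (s≤s (s≤s (s≤s ()))))
defect-superadditive {suc (suc (suc a))} {suc (suc b)} _ _ (s≤s (s≤s (s≤s h))) =
  contradiction (m+n≤o⇒n≤o a h) λ { (s≤s ()) }
defect-superadditive {suc (suc (suc (suc a)))} {suc b} _ _ (s≤s (s≤s (s≤s (s≤s h)))) =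
  contradiction (m+n≤o⇒n≤o a h) λ ()

NbhdBound : (n : ℕ) → List (Vertex n) → Set
NbhdBound n S = card S * (2 * n) + antipodalCount S ≤ nbhdSize S + defect (card S)

NbhdBound-zero : (S : List (Vertex 0)) → card S ≤ 4 → NbhdBound 0 S
NbhdBound-zero S k≤4 = begin
  card S * 0 + antipodalCount S ≡⟨ cong (_+ antipodalCount S) (*-zeroʳ (card S)) ⟩
  antipodalCount S              ≤⟨ antipodalCount≤card S ⟩
  card S                        ≤⟨ ≤-defect (card S) k≤4 ⟩
  defect (card S)               ≤⟨ m≤n+m (defect (card S)) (nbhdSize S) ⟩
  nbhdSize S + defect (card S)  ∎
  where open ≤-Reasoning

oneLayer-arith : ∀ a n q X N₀ N c → a * (2 * n) + q ≤ N₀ + c → X + q ≡ a + a → N₀ + X ≤ N →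
                 a * (2 * suc n) + 0 ≤ N + c
oneLayer-arith a n q X N₀ N c ih X+q≡2a N₀+X≤N = begin
  a * (2 * suc n) + 0   ≡⟨ distrib a n ⟩
  a * (2 * n) + (a + a) ≡⟨ cong (a * (2 * n) +_) X+q≡2a ⟨
  a * (2 * n) + (X + q) ≡⟨ x∙yz≈xz∙y (a * (2 * n)) X q ⟩
  a * (2 * n) + q + X   ≤⟨ +-monoˡ-≤ X ih ⟩
  N₀ + c + X            ≡⟨ xy∙z≈xz∙y N₀ c X ⟩
  N₀ + X + c            ≤⟨ +-monoˡ-≤ c N₀+X≤N ⟩
  N + c                 ∎
  where
  open ≤-Reasoning
  distrib : ∀ a n → a * (2 * suc n) + 0 ≡ a * (2 * n) + (a + a)
  distrib = solve-∀

twoLayers-arith : ∀ a b n q N₀ N₁ N c₀ c₁ c → a * (2 * n) ≤ N₀ + c₀ → b * (2 * n) ≤ N₁ + c₁ →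
                  q ≤ a + b → N₀ + N₁ ≤ N → c₀ + c₁ + 3 * (a + b) ≤ c → (a + b) * (2 * suc n) + q ≤ N + c
twoLayers-arith a b n q N₀ N₁ N c₀ c₁ c ih₀ ih₁ q≤a+b N₀+N₁≤N c₀+c₁≤c = begin
  (a + b) * (2 * suc n) + q               ≤⟨ +-monoʳ-≤ ((a + b) * (2 * suc n)) q≤a+b ⟩
  (a + b) * (2 * suc n) + (a + b)         ≡⟨ distrib a b n ⟩
  a * (2 * n) + b * (2 * n) + 3 * (a + b) ≤⟨ +-monoˡ-≤ (3 * (a + b)) (+-mono-≤ ih₀ ih₁) ⟩
  N₀ + c₀ + (N₁ + c₁) + 3 * (a + b)       ≡⟨ cong (_+ 3 * (a + b)) (interchange N₀ c₀ N₁ c₁) ⟩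
  N₀ + N₁ + (c₀ + c₁) + 3 * (a + b)       ≡⟨ +-assoc (N₀ + N₁) (c₀ + c₁) (3 * (a + b)) ⟩
  N₀ + N₁ + (c₀ + c₁ + 3 * (a + b))       ≤⟨ +-mono-≤ N₀+N₁≤N c₀+c₁≤c ⟩
  N + c                                   ∎
  where
  open ≤-Reasoning
  distrib : ∀ a b n → (a + b) * (2 * suc n) + (a + b) ≡ a * (2 * n) + b * (2 * n) + 3 * (a + b)
  distrib = solve-∀

NbhdBound-oneLayer : ∀ β (S : List (Vertex (suc n))) → card (layer (not β) S) ≡ 0 →
                     NbhdBound n (layer β S) → NbhdBound (suc n) S
NbhdBound-oneLayer {n} β S empty ih =
  subst₂ (λ k q → k * (2 * suc n) + q ≤ nbhdSize S + defect k)
         (sym card≡a) (sym (antipodalCount-emptyLayer (not β) S empty))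
    (oneLayer-arith a n (antipodalCount T) X (nbhdSize T) (nbhdSize S) (defect a)
                    ih (card-∪-complement T) N₀+X≤N)
  where
  T = layer β S
  a = card T
  X = countAll (λ V → V ∈? T ⊎-dec complement V ∈? T)
  card≡a : card S ≡ a
  card≡a = trans (card-layers β S) (trans (cong (a +_) empty) (+-identityʳ a))
  X≤ : X ≤ countAll (λ V → inNbhd? S (V ∷ʳ not β))
  X≤ = count-mono (λ V → V ∈? T ⊎-dec complement V ∈? T) (λ V → inNbhd? S (V ∷ʳ not β))
                  (crossNeighbour β S empty) (allVertices n)
  N₀+X≤N : nbhdSize T + X ≤ nbhdSize S
  N₀+X≤N = subst (nbhdSize T + X ≤_) (sym (countAll-∷ʳ-not β (inNbhd? S)))
                 (+-mono-≤ (nbhdSize-layer≤ β S) X≤)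

NbhdBound-twoLayers : (S : List (Vertex (suc n))) → card S ≤ 4 →
                      1 ≤ card (layer false S) → 1 ≤ card (layer true S) →
                      NbhdBound n (layer false S) → NbhdBound n (layer true S) → NbhdBound (suc n) S
NbhdBound-twoLayers {n} S k≤4 1≤a 1≤b ih₀ ih₁ =
  subst (λ k → k * (2 * suc n) + antipodalCount S ≤ nbhdSize S + defect k) (sym card≡a+b)
    (twoLayers-arith a b n (antipodalCount S) (nbhdSize T₀) (nbhdSize T₁) (nbhdSize S)
                     (defect a) (defect b) (defect (a + b))
      (≤-trans (m≤m+n _ (antipodalCount T₀)) ih₀) (≤-trans (m≤m+n _ (antipodalCount T₁)) ih₁)
      (subst (antipodalCount S ≤_) card≡a+b (antipodalCount≤card S))
      (nbhdSize-layers false S)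
      (defect-superadditive 1≤a 1≤b (subst (_≤ 4) card≡a+b k≤4)))
  where
  T₀ = layer false S
  T₁ = layer true S
  a = card T₀
  b = card T₁
  card≡a+b : card S ≡ a + b
  card≡a+b = card-layers false S

nbhdBound : ∀ n (S : List (Vertex n)) → card S ≤ 4 → NbhdBound n S
nbhdBound zero    S k≤4 = NbhdBound-zero S k≤4
nbhdBound (suc n) S k≤4 = byLayerSizes (card (layer false S)) (card (layer true S)) refl refl
  where
  ih : ∀ β → NbhdBound n (layer β S)
  ih β = nbhdBound n (layer β S) (≤-trans (card-layer≤ β S) k≤4)
  positive : ∀ {k m} → k ≡ suc m → 1 ≤ k
  positive refl = s≤s z≤n
  byLayerSizes : ∀ a b → card (layer false S) ≡ a → card (layer true S) ≡ b → NbhdBound (suc n) S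
  byLayerSizes _       zero    _  e₁ = NbhdBound-oneLayer false S e₁ (ih false)
  byLayerSizes zero    (suc _) e₀ _  = NbhdBound-oneLayer true S e₀ (ih true)
  byLayerSizes (suc _) (suc _) e₀ e₁ =
    NbhdBound-twoLayers S k≤4 (positive e₀) (positive e₁) (ih false) (ih true)

2≤antipodalCount-pair : ∀ {X : Vertex n} {S} → X ≢ complement X → X ∈ S → complement X ∈ S →
                        2 ≤ antipodalCount S
2≤antipodalCount-pair {n} {X} {S} X≢X̄ X∈S X̄∈S =
  subst (_≤ antipodalCount S) (card-unique (X ∷ complement X ∷ []) ((X≢X̄ ∷ []) ∷ [] ∷ []))
    (count-mono (_∈? (X ∷ complement X ∷ [])) (λ V → V ∈? S ×-dec complement V ∈? S) pair (allVertices n))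
  where
  pair : ∀ {V} → V ∈ X ∷ complement X ∷ [] → V ∈ S × complement V ∈ S
  pair (here refl)         = X∈S , X̄∈S
  pair (there (here refl)) = X̄∈S , subst (_∈ S) (sym (complement-involutive X)) X∈S

m+k≤n+[k+o]⇒m∸o≤n : ∀ m k n o → m + k ≤ n + (k + o) → m ∸ o ≤ n
m+k≤n+[k+o]⇒m∸o≤n m k n o le = m≤n+o⇒m∸n≤o m o
  (+-cancelʳ-≤ k m (o + n) (subst (m + k ≤_) (x∙yz≈zx∙y n k o) le))

lemma2p7 : (n : ℕ) → 5 ≤ n → (Y X Z U : Vertex n) → IsPath2 Y X Z →
    InNbhd (Y ∷ X ∷ Z ∷ []) U →
    (8 * n ∸ 31 ≤ nbhdSize (U ∷ X ∷ Y ∷ Z ∷ []))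
    × (Z ≡ flipTop X → 8 * n ∸ 29 ≤ nbhdSize (U ∷ X ∷ Y ∷ Z ∷ []))
lemma2p7 n _ Y X Z U ((Y≢X , _) , (X≢Z , _) , Y≢Z) (_ , U∉YXZ) =
  m+k≤n+[k+o]⇒m∸o≤n (8 * n) 0 (nbhdSize S) 31 (≤-trans (+-monoʳ-≤ (8 * n) z≤n) bound) ,
  λ Z≡X̄ → m+k≤n+[k+o]⇒m∸o≤n (8 * n) 2 (nbhdSize S) 29
            (≤-trans (+-monoʳ-≤ (8 * n) (2≤antipodalCount Z≡X̄)) bound)
  where
  S = U ∷ X ∷ Y ∷ Z ∷ []
  card≡4 : card S ≡ 4
  card≡4 = card-unique S ( (U∉YXZ ∘ there ∘ here ∷ U∉YXZ ∘ here ∷ U∉YXZ ∘ there ∘ there ∘ here ∷ [])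
                         ∷ (Y≢X ∘ sym ∷ X≢Z ∷ []) ∷ (Y≢Z ∷ []) ∷ [] ∷ [])
  bound : 8 * n + antipodalCount S ≤ nbhdSize S + 31
  bound = subst (λ m → m + antipodalCount S ≤ nbhdSize S + 31) (sym (*-assoc 4 2 n))
    (subst (λ k → k * (2 * n) + antipodalCount S ≤ nbhdSize S + defect k) card≡4
      (nbhdBound n S (≤-reflexive card≡4)))
  2≤antipodalCount : Z ≡ flipTop X → 2 ≤ antipodalCount S
  2≤antipodalCount Z≡X̄ = 2≤antipodalCount-pair (subst (X ≢_) Z≡complementX X≢Z)
    (there (here refl)) (there (there (there (here (sym Z≡complementX)))))
    where
    Z≡complementX : Z ≡ complement X
    Z≡complementX = trans Z≡X̄ (flipTop≡complement X)
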